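{- Let $m,n$ be positive integers and $W=W^{(m)}_n$. Then $f_0$ maps $A_0$ into $B_0$, $g_0$ maps $B_0$ into $A_0$, and $g_0\circ f_0$ and $f_0\circ g_0$ are the identity maps on $A_0$ and $B_0$ respectively; i.e., $f_0:A_0\to B_0$ is a bijection with inverse $g_0$.
   Context: An $m$-Dyck word of length $n$ is a sequence $\gamma=(\gamma_0,\dots,\gamma_{n-1})$ of nonnegative integers with $\gamma_0=0$ and $\gamma_i\le\gamma_{i-1}+m$ for $1\le i<n$; $W=W^{(m)}_n$ is the set of these. For $\gamma\in W$, let $r=r(\gamma)$ be the minimum index $i\in\{2,\dots,n-1\}$ with $\gamma_i-\gamma_{i-2}\le m$, or $r=n$ if none exists. $A_0$ is the set of $\gamma\in W$ with $\gamma_{r-1}-1\le\gamma_{n-1}+m$ and $\gamma_1>0$, and for $\gamma\in A_0$, $f_0(\gamma)=(\gamma_0,\dots,\gamma_{r-2},\gamma_r,\dots,\gamma_{n-1},\gamma_{r-1}-1)$. For $\gamma\in W$, let $r'=r'(\gamma)$ be the minimum index $i\in\{2,\dots,n\}$ with $\gamma_{i-2}\ge\gamma_{n-1}+1-m$, or $r'=0$ if none exists. $B_0$ is the set of $\gamma\in W$ such that $r'(\gamma)>0$, $\gamma_{r'-1}\le\gamma_{n-1}+1+m$, and $\gamma_i-\gamma_{i-2}>m$ for $2\le i\le r'-2$. For $\gamma\in B_0$, $g_0(\gamma)=(\gamma_0,\dots,\gamma_{r'-2},\gamma_{n-1}+1,\gamma_{r'-1},\dots,\gamma_{n-2})$.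 -}

module Defs where

open import Data.Nat using (ℕ; zero; suc; _+_; _∸_; _≤_; _<_; _≤ᵇ_)
open import Data.Bool using (Bool; true; false; if_then_else_)
open import Data.List using (List; []; _∷_; _++_; take; drop; length; [_])
open import Data.Maybe using (Maybe; just; nothing; fromMaybe)
open import Data.Product using (_×_)
open import Relation.Binary.PropositionalEquality using (_≡_)

-- γ_i : the i-th entry (0-based) of a word; 0 outside the range
-- (only ever used with in-range indices below).
at : List ℕ → ℕ → ℕ
at []       _       = 0
at (x ∷ xs) zero    = x
at (x ∷ xs) (suc i) = at xs i

search : (ℕ → Bool) → ℕ → ℕ → Maybe ℕ
search p start zero        = nothing
search p start (suc count) =
  if p start then just start else search p (suc start) count

W : ℕ → ℕ → List ℕ → Set
W m n γ = length γ ≡ n × at γ 0 ≡ 0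
        × (∀ i → 1 ≤ i → i < n → at γ i ≤ at γ (i ∸ 1) + m)

lastOf : ℕ → List ℕ → ℕ
lastOf n γ = at γ (n ∸ 1)

r : ℕ → ℕ → List ℕ → ℕ
r m n γ = fromMaybe n (search (λ i → at γ i ≤ᵇ at γ (i ∸ 2) + m) 2 (n ∸ 2))

-- r'(γ): min i ∈ {2,…,n} with γ_{i-2} ≥ γ_{n-1} + 1 - m, else 0
-- (integer inequality written as γ_{i-2} + m ≥ γ_{n-1} + 1)
r' : ℕ → ℕ → List ℕ → ℕ
r' m n γ = fromMaybe 0
  (search (λ i → suc (lastOf n γ) ≤ᵇ at γ (i ∸ 2) + m) 2 (n ∸ 1))

-- A_0: γ_{r-1} - 1 ≤ γ_{n-1} + m (written γ_{r-1} ≤ γ_{n-1} + m + 1) and γ_1 > 0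
-- (γ_1 > 0 is read as requiring that γ_1 exists, i.e. 1 < n)
A₀ : ℕ → ℕ → List ℕ → Set
A₀ m n γ = W m n γ
         × at γ (r m n γ ∸ 1) ≤ suc (lastOf n γ + m)
         × 1 < n × 0 < at γ 1

f₀ : ℕ → ℕ → List ℕ → List ℕ
f₀ m n γ = take (r m n γ ∸ 1) γ ++ drop (r m n γ) γ
           ++ [ at γ (r m n γ ∸ 1) ∸ 1 ]

B₀ : ℕ → ℕ → List ℕ → Set
B₀ m n γ = W m n γ
         × 0 < r' m n γ
         × at γ (r' m n γ ∸ 1) ≤ suc (lastOf n γ) + m
         × (∀ i → 2 ≤ i → i ≤ r' m n γ ∸ 2 → at γ (i ∸ 2) + m < at γ i)

g₀ : ℕ → ℕ → List ℕ → List ℕ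
g₀ m n γ = take (r' m n γ ∸ 1) γ ++ [ suc (lastOf n γ) ]
           ++ drop (r' m n γ ∸ 1) (take (n ∸ 1) γ)

-- Write q = r(γ) − 1, a 0-based position, and N + 1 for the length. The conditions
-- defining r say that γ overshoots by more than m over every double step up to q,
-- which (with the single steps γ_{j+1} ≤ γ_j + m) forces γ_j + m < γ_q for j ≤ q − 2;
-- in particular γ_q > 0. Hence δ = f₀(γ) has δ_N + 1 = γ_q, and the same
-- inequalities, read on δ, say exactly that r'(δ) − 1 = q and δ ∈ B₀, while
-- reinserting δ_N + 1 at position q restores γ. Symmetrically, for ε = g₀(γ) with
-- q = r'(γ) − 1 the conditions of B₀ say that r(ε) − 1 = q and ε ∈ A₀, and removing
-- ε_q = γ_N + 1 again restores γ.

module Submission where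

open import Defs
open import Data.Nat
open import Data.Nat.Properties
open import Data.Bool using (Bool; true; false; T)
open import Data.Unit using (tt)
open import Data.List using (List; []; _∷_; _++_; take; drop; length; [_])
open import Data.List.Properties using (length-++; length-take; length-drop)
open import Data.Maybe using (Maybe; just; nothing; fromMaybe)
open import Data.Product using (Σ; _×_; _,_; proj₁; proj₂)
open import Data.Sum using (inj₁; inj₂)
open import Function using (_∘_)
open import Relation.Nullary using (¬_; contradiction; yes; no)
open import Relation.Binary.Definitions using (tri<; tri≈; tri>)
open import Relation.Binary.PropositionalEquality hiding ([_])

≤ᵇ-false⇒> : ∀ a b → ¬ T (a ≤ᵇ b) → b < a
≤ᵇ-false⇒> a b a≰ᵇb = ≰⇒> (a≰ᵇb ∘ ≤⇒≤ᵇ)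

>⇒≤ᵇ-false : ∀ {a b} → b < a → ¬ T (a ≤ᵇ b)
>⇒≤ᵇ-false {a} {b} b<a = <⇒≱ b<a ∘ ≤ᵇ⇒≤ a b

data SearchView (p : ℕ → Bool) (s c : ℕ) : Maybe ℕ → Set where
  hit  : ∀ {k} → s ≤ k → k < s + c → T (p k) →
         (∀ j → s ≤ j → j < k → ¬ T (p j)) → SearchView p s c (just k)
  miss : (∀ j → s ≤ j → j < s + c → ¬ T (p j)) → SearchView p s c nothing

fails-from : ∀ {p : ℕ → Bool} {s b} → ¬ T (p s) →
  (∀ j → suc s ≤ j → j < b → ¬ T (p j)) → ∀ j → s ≤ j → j < b → ¬ T (p j)
fails-from ¬ps fails j s≤j j<b with m≤n⇒m<n∨m≡n s≤j
... | inj₁ s<j  = fails j s<j j<b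
... | inj₂ refl = ¬ps

search-view : ∀ p s c → SearchView p s c (search p s c)
search-view p s zero =
  miss λ j s≤j j<s+0 → contradiction s≤j (<⇒≱ (subst (j <_) (+-identityʳ s) j<s+0))
search-view p s (suc c) with p s in ps
... | true = hit ≤-refl (m<m+n s z<s) (subst T (sym ps) tt)
               λ j s≤j j<s → contradiction s≤j (<⇒≱ j<s)
... | false with search p (suc s) c | search-view p (suc s) c
...   | _ | hit {k} s<k k<1+s+c pk first =
        hit (<⇒≤ s<k) (subst (k <_) (sym (+-suc s c)) k<1+s+c) pk (fails-from (subst T ps) first)
...   | _ | miss none =
        miss λ j s≤j j<s+1+c → fails-from (subst T ps) none j s≤j (subst (j <_) (+-suc s c) j<s+1+c)

search-hit : ∀ {p s c k} → s ≤ k → k < s + c → T (p k) →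
  (∀ j → s ≤ j → j < k → ¬ T (p j)) → search p s c ≡ just k
search-hit {p} {s} {c} {k} s≤k k<s+c pk first with search p s c | search-view p s c
... | nothing | miss none = contradiction pk (none k s≤k k<s+c)
... | just k′ | hit s≤k′ _ pk′ first′ with <-cmp k k′
...   | tri< k<k′ _ _ = contradiction pk (first′ k s≤k k<k′)
...   | tri≈ _ refl _ = refl
...   | tri> _ _ k′<k = contradiction pk′ (first k′ s≤k′ k′<k)

search-miss : ∀ {p s c} → (∀ j → s ≤ j → j < s + c → ¬ T (p j)) → search p s c ≡ nothing
search-miss {p} {s} {c} none with search p s c | search-view p s c
... | nothing | _                  = refl
... | just k  | hit s≤k k<s+c pk _ = contradiction pk (none k s≤k k<s+c)

-- For a word of length suc N, q = r(γ) − 1: the position of the entry that f₀ moves to the end.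
record RCut (m N : ℕ) (γ : List ℕ) (q : ℕ) : Set where
  field
    1≤q    : 1 ≤ q
    q≤N    : q ≤ N
    stops  : q < N → at γ (suc q) ≤ at γ (q ∸ 1) + m
    climbs : ∀ j → 2 ≤ j → j ≤ q → at γ (j ∸ 2) + m < at γ j

-- For a word of length suc N, q = r'(γ) − 1: the position at which g₀ inserts γ_N + 1.
record R'Cut (m N : ℕ) (γ : List ℕ) (q : ℕ) : Set where
  field
    1≤q     : 1 ≤ q
    q≤N     : q ≤ N
    reaches : suc (at γ N) ≤ at γ (q ∸ 1) + m
    below   : ∀ j → 2 ≤ j → j ≤ q → at γ (j ∸ 2) + m ≤ at γ N

r-cut : ∀ m N γ → Σ ℕ λ q → r m (suc (suc N)) γ ≡ suc q × RCut m (suc N) γ q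
r-cut m N γ with search (λ i → at γ i ≤ᵇ at γ (i ∸ 2) + m) 2 N
               | search-view (λ i → at γ i ≤ᵇ at γ (i ∸ 2) + m) 2 N
... | nothing | miss none = suc N , refl , record
  { 1≤q    = s≤s z≤n
  ; q≤N    = ≤-refl
  ; stops  = λ N<N → contradiction N<N (<-irrefl refl)
  ; climbs = λ j 2≤j j≤1+N → ≤ᵇ-false⇒> _ _ (none j 2≤j (s≤s j≤1+N))
  }
... | just (suc q) | hit (s≤s 1≤q) 1+q<2+N stop first = q , refl , record
  { 1≤q    = 1≤q
  ; q≤N    = m≤n⇒m≤1+n (≤-pred (≤-pred 1+q<2+N))
  ; stops  = λ _ → ≤ᵇ⇒≤ _ _ stop
  ; climbs = λ j 2≤j j≤q → ≤ᵇ-false⇒> _ _ (first j 2≤j (s≤s j≤q))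
  }

RCut⇒r≡ : ∀ {m N γ q} → RCut m N γ q → r m (suc N) γ ≡ suc q
RCut⇒r≡ {N = zero} record { 1≤q = 1≤q ; q≤N = q≤N } = contradiction (≤-trans 1≤q q≤N) λ ()
RCut⇒r≡ {N = suc N} record { 1≤q = 1≤q ; q≤N = q≤N ; stops = stops ; climbs = climbs }
  with m≤n⇒m<n∨m≡n q≤N
... | inj₁ q<1+N = cong (fromMaybe _) (search-hit (s≤s 1≤q) (s≤s q<1+N) (≤⇒≤ᵇ (stops q<1+N))
                     λ j 2≤j j≤q → >⇒≤ᵇ-false (climbs j 2≤j (≤-pred j≤q)))
... | inj₂ refl  = cong (fromMaybe _) (search-miss
                     λ j 2≤j j<2+N → >⇒≤ᵇ-false (climbs j 2≤j (≤-pred j<2+N)))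

r'-cut : ∀ m N γ → 0 < r' m (suc N) γ → Σ ℕ λ q → r' m (suc N) γ ≡ suc q × R'Cut m N γ q
r'-cut m N γ r'>0 with search (λ i → suc (at γ N) ≤ᵇ at γ (i ∸ 2) + m) 2 N
                     | search-view (λ i → suc (at γ N) ≤ᵇ at γ (i ∸ 2) + m) 2 N
... | nothing      | _ = contradiction r'>0 (<-irrefl refl)
... | just (suc q) | hit (s≤s 1≤q) 1+q<2+N reach first = q , refl , record
  { 1≤q     = 1≤q
  ; q≤N     = ≤-pred (≤-pred 1+q<2+N)
  ; reaches = ≤ᵇ⇒≤ _ _ reach
  ; below   = λ j 2≤j j≤q → ≤-pred (≤ᵇ-false⇒> _ _ (first j 2≤j (s≤s j≤q)))
  }

R'Cut⇒r'≡ : ∀ {m N γ q} → R'Cut m N γ q → r' m (suc N) γ ≡ suc q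
R'Cut⇒r'≡ record { 1≤q = 1≤q ; q≤N = q≤N ; reaches = reaches ; below = below } =
  cong (fromMaybe 0) (search-hit (s≤s 1≤q) (s≤s (s≤s q≤N)) (≤⇒≤ᵇ reaches)
    λ j 2≤j j≤q → >⇒≤ᵇ-false (s≤s (below j 2≤j (≤-pred j≤q))))

at-++ˡ : ∀ (xs ys : List ℕ) {i} → i < length xs → at (xs ++ ys) i ≡ at xs i
at-++ˡ (x ∷ xs) ys {zero}  _         = refl
at-++ˡ (x ∷ xs) ys {suc i} (s≤s i<n) = at-++ˡ xs ys i<n

at-++ʳ : ∀ (xs ys : List ℕ) j → at (xs ++ ys) (length xs + j) ≡ at ys j
at-++ʳ []       ys j = refl
at-++ʳ (x ∷ xs) ys j = at-++ʳ xs ys j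

at-++-from : ∀ (xs ys : List ℕ) {k i} → length xs ≡ k → k ≤ i →
  at (xs ++ ys) i ≡ at ys (i ∸ k)
at-++-from xs ys {i = i} refl k≤i =
  trans (cong (at (xs ++ ys)) (sym (m+[n∸m]≡n k≤i))) (at-++ʳ xs ys (i ∸ length xs))

at-take : ∀ k (xs : List ℕ) {i} → i < k → at (take k xs) i ≡ at xs i
at-take (suc k) []       _                 = refl
at-take (suc k) (x ∷ xs) {zero}  _         = refl
at-take (suc k) (x ∷ xs) {suc i} (s≤s i<k) = at-take k xs i<k

at-drop : ∀ k (xs : List ℕ) j → at (drop k xs) j ≡ at xs (k + j)
at-drop zero    xs       j = refl
at-drop (suc k) []       j = refl
at-drop (suc k) (x ∷ xs) j = at-drop k xs j

length-take-≤ : ∀ k (xs : List ℕ) → k ≤ length xs → length (take k xs) ≡ k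
length-take-≤ k xs k≤n = trans (length-take k xs) (m≤n⇒m⊓n≡m k≤n)

at-ext : ∀ (xs ys : List ℕ) → length xs ≡ length ys →
  (∀ i → i < length xs → at xs i ≡ at ys i) → xs ≡ ys
at-ext []       []       _  _    = refl
at-ext (x ∷ xs) (y ∷ ys) eq same =
  cong₂ _∷_ (same 0 z<s) (at-ext xs ys (suc-injective eq) λ i i<n → same (suc i) (s≤s i<n))

f₀-at : ℕ → List ℕ → List ℕ
f₀-at q γ = take q γ ++ drop (suc q) γ ++ [ at γ q ∸ 1 ]

g₀-at : ℕ → ℕ → List ℕ → List ℕ
g₀-at N q γ = take q γ ++ [ suc (at γ N) ] ++ drop q (take N γ)

f₀≡f₀-at : ∀ {m n γ q} → r m n γ ≡ suc q → f₀ m n γ ≡ f₀-at q γ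
f₀≡f₀-at {γ = γ} r≡1+q =
  cong (λ R → take (R ∸ 1) γ ++ drop R γ ++ [ at γ (R ∸ 1) ∸ 1 ]) r≡1+q

g₀≡g₀-at : ∀ {m N γ q} → r' m (suc N) γ ≡ suc q → g₀ m (suc N) γ ≡ g₀-at N q γ
g₀≡g₀-at {N = N} {γ} r'≡1+q =
  cong (λ R → take (R ∸ 1) γ ++ [ suc (at γ N) ] ++ drop (R ∸ 1) (take N γ)) r'≡1+q

module Positions (γ : List ℕ) {N q : ℕ} (length-γ : length γ ≡ suc N) (q≤N : q ≤ N) where

  open ≡-Reasoning

  private
    length-prefix : length (take q γ) ≡ q
    length-prefix = length-take-≤ q γ (subst (q ≤_) (sym length-γ) (m≤n⇒m≤1+n q≤N))

    length-suffix : length (drop (suc q) γ) ≡ N ∸ q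
    length-suffix = trans (length-drop (suc q) γ) (cong (_∸ suc q) length-γ)

    length-middle : length (drop q (take N γ)) ≡ N ∸ q
    length-middle = trans (length-drop q (take N γ))
      (cong (_∸ q) (length-take-≤ N γ (subst (N ≤_) (sym length-γ) (n≤1+n N))))

    q+[1+N∸q]≡1+N : q + suc (N ∸ q) ≡ suc N
    q+[1+N∸q]≡1+N = trans (+-suc q (N ∸ q)) (cong suc (m+[n∸m]≡n q≤N))

  length-f₀-at : length (f₀-at q γ) ≡ suc N
  length-f₀-at = begin
    length (f₀-at q γ)
      ≡⟨ length-++ (take q γ) ⟩
    length (take q γ) + length (drop (suc q) γ ++ [ at γ q ∸ 1 ])
      ≡⟨ cong₂ _+_ length-prefix (length-++ (drop (suc q) γ)) ⟩
    q + (length (drop (suc q) γ) + 1)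
      ≡⟨ cong (λ l → q + (l + 1)) length-suffix ⟩
    q + (N ∸ q + 1)
      ≡⟨ cong (q +_) (+-comm (N ∸ q) 1) ⟩
    q + suc (N ∸ q)
      ≡⟨ q+[1+N∸q]≡1+N ⟩
    suc N ∎

  length-g₀-at : length (g₀-at N q γ) ≡ suc N
  length-g₀-at = begin
    length (g₀-at N q γ)
      ≡⟨ length-++ (take q γ) ⟩
    length (take q γ) + suc (length (drop q (take N γ)))
      ≡⟨ cong₂ (λ a b → a + suc b) length-prefix length-middle ⟩
    q + suc (N ∸ q)
      ≡⟨ q+[1+N∸q]≡1+N ⟩
    suc N ∎

  f₀-at-below : ∀ {i} → i < q → at (f₀-at q γ) i ≡ at γ i
  f₀-at-below i<q =
    trans (at-++ˡ (take q γ) _ (subst (_ <_) (sym length-prefix) i<q)) (at-take q γ i<q)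

  f₀-at-above : ∀ {i} → q ≤ i → i < N → at (f₀-at q γ) i ≡ at γ (suc i)
  f₀-at-above {i} q≤i i<N = begin
    at (f₀-at q γ) i
      ≡⟨ at-++-from (take q γ) _ length-prefix q≤i ⟩
    at (drop (suc q) γ ++ [ at γ q ∸ 1 ]) (i ∸ q)
      ≡⟨ at-++ˡ (drop (suc q) γ) _ i∸q<length ⟩
    at (drop (suc q) γ) (i ∸ q)
      ≡⟨ at-drop (suc q) γ (i ∸ q) ⟩
    at γ (suc (q + (i ∸ q)))
      ≡⟨ cong (at γ ∘ suc) (m+[n∸m]≡n q≤i) ⟩
    at γ (suc i) ∎
    where
    i∸q<length : i ∸ q < length (drop (suc q) γ)
    i∸q<length = subst (i ∸ q <_) (sym length-suffix) (∸-monoˡ-< i<N q≤i)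

  f₀-at-last : at (f₀-at q γ) N ≡ at γ q ∸ 1
  f₀-at-last = begin
    at (f₀-at q γ) N
      ≡⟨ at-++-from (take q γ) _ length-prefix q≤N ⟩
    at (drop (suc q) γ ++ [ at γ q ∸ 1 ]) (N ∸ q)
      ≡⟨ at-++-from (drop (suc q) γ) _ length-suffix ≤-refl ⟩
    at [ at γ q ∸ 1 ] (N ∸ q ∸ (N ∸ q))
      ≡⟨ cong (at [ at γ q ∸ 1 ]) (n∸n≡0 (N ∸ q)) ⟩
    at γ q ∸ 1 ∎

  g₀-at-below : ∀ {i} → i < q → at (g₀-at N q γ) i ≡ at γ i
  g₀-at-below i<q =
    trans (at-++ˡ (take q γ) _ (subst (_ <_) (sym length-prefix) i<q)) (at-take q γ i<q)

  g₀-at-inserted : at (g₀-at N q γ) q ≡ suc (at γ N)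
  g₀-at-inserted = begin
    at (g₀-at N q γ) q
      ≡⟨ at-++-from (take q γ) _ length-prefix ≤-refl ⟩
    at (suc (at γ N) ∷ drop q (take N γ)) (q ∸ q)
      ≡⟨ cong (at (suc (at γ N) ∷ drop q (take N γ))) (n∸n≡0 q) ⟩
    suc (at γ N) ∎

  g₀-at-above : ∀ {i} → q ≤ i → i < N → at (g₀-at N q γ) (suc i) ≡ at γ i
  g₀-at-above {i} q≤i i<N = begin
    at (g₀-at N q γ) (suc i)
      ≡⟨ at-++-from (take q γ) _ length-prefix (m≤n⇒m≤1+n q≤i) ⟩
    at (suc (at γ N) ∷ drop q (take N γ)) (suc i ∸ q)
      ≡⟨ cong (at (suc (at γ N) ∷ drop q (take N γ))) (+-∸-assoc 1 q≤i) ⟩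
    at (drop q (take N γ)) (i ∸ q)
      ≡⟨ at-drop q (take N γ) (i ∸ q) ⟩
    at (take N γ) (q + (i ∸ q))
      ≡⟨ cong (at (take N γ)) (m+[n∸m]≡n q≤i) ⟩
    at (take N γ) i
      ≡⟨ at-take N γ i<N ⟩
    at γ i ∎

g₀-at∘f₀-at : ∀ {N q} γ → length γ ≡ suc N → q ≤ N → 0 < at γ q →
  g₀-at N q (f₀-at q γ) ≡ γ
g₀-at∘f₀-at {N} {q} γ length-γ q≤N γq>0 =
  at-ext _ γ (trans G.length-g₀-at (sym length-γ)) pointwise
  where
  module F = Positions γ length-γ q≤N
  module G = Positions (f₀-at q γ) F.length-f₀-at q≤N

  pointwise : ∀ i → i < length (g₀-at N q (f₀-at q γ)) → at (g₀-at N q (f₀-at q γ)) i ≡ at γ i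
  pointwise i _ with <-cmp i q
  ... | tri< i<q _ _  = trans (G.g₀-at-below i<q) (F.f₀-at-below i<q)
  ... | tri≈ _ refl _ =
    trans G.g₀-at-inserted (trans (cong suc F.f₀-at-last) (suc-pred (at γ q) {{>-nonZero γq>0}}))
  pointwise (suc k) 1+k<1+N | tri> _ _ q<1+k =
    trans (G.g₀-at-above q≤k k<N) (F.f₀-at-above q≤k k<N)
    where
    q≤k : q ≤ k
    q≤k = ≤-pred q<1+k
    k<N : k < N
    k<N = ≤-pred (subst (suc k <_) G.length-g₀-at 1+k<1+N)

f₀-at∘g₀-at : ∀ {N q} γ → length γ ≡ suc N → q ≤ N → f₀-at q (g₀-at N q γ) ≡ γ
f₀-at∘g₀-at {N} {q} γ length-γ q≤N =
  at-ext _ γ (trans F.length-f₀-at (sym length-γ)) pointwise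
  where
  module G = Positions γ length-γ q≤N
  module F = Positions (g₀-at N q γ) G.length-g₀-at q≤N

  pointwise : ∀ i → i < length (f₀-at q (g₀-at N q γ)) → at (f₀-at q (g₀-at N q γ)) i ≡ at γ i
  pointwise i i<1+N with i <? q
  ... | yes i<q = trans (F.f₀-at-below i<q) (G.g₀-at-below i<q)
  ... | no i≮q with m≤n⇒m<n∨m≡n (≤-pred (subst (i <_) F.length-f₀-at i<1+N))
  ...   | inj₁ i<N  = trans (F.f₀-at-above (≮⇒≥ i≮q) i<N) (G.g₀-at-above (≮⇒≥ i≮q) i<N)
  ...   | inj₂ refl = trans F.f₀-at-last (cong (_∸ 1) G.g₀-at-inserted)

Steps : ℕ → ℕ → List ℕ → Set
Steps m N γ = ∀ {k} → k < N → at γ (suc k) ≤ at γ k + m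

W⇒Steps : ∀ {m N} γ → W m (suc N) γ → Steps m N γ
W⇒Steps _ (_ , _ , step) k<N = step _ (s≤s z≤n) (s≤s k<N)

Steps⇒W : ∀ {m N} γ → length γ ≡ suc N → at γ 0 ≡ 0 → Steps m N γ → W m (suc N) γ
Steps⇒W _ length-γ γ₀≡0 steps =
  length-γ , γ₀≡0 , λ { zero () _ ; (suc k) _ (s≤s k<N) → steps k<N }

step-into : ∀ {m N q} γ → Steps m N γ → 1 ≤ q → q ≤ N → at γ q ≤ at γ (q ∸ 1) + m
step-into {q = suc q} _ steps _ q<N = steps q<N

-- a_j + m < a_{j+2} ≤ a_{j+1} + m, so a_j + m < a_{j+1} + m < ⋯ < a_t.
overshoot-chain : ∀ (a : ℕ → ℕ) m t →
  (∀ j → suc (suc j) ≤ t → a j + m < a (suc (suc j))) →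
  (∀ j → suc (suc j) ≤ t → a (suc (suc j)) ≤ a (suc j) + m) →
  ∀ j → suc (suc j) ≤ t → a j + m < a t
overshoot-chain a m t overshoot step j 2+j≤t = go (t ∸ suc (suc j)) j (m∸n+n≡m 2+j≤t)
  where
  go : ∀ d j → d + suc (suc j) ≡ t → a j + m < a t
  go zero    j 2+j≡t = subst (λ i → a j + m < a i) 2+j≡t (overshoot j (≤-reflexive 2+j≡t))
  go (suc d) j d+3+j≡t =
    <-trans (<-≤-trans (overshoot j 2+j≤t′) (step j 2+j≤t′))
            (go d (suc j) (trans (+-suc d (suc (suc j))) d+3+j≡t))
    where
    2+j≤t′ : suc (suc j) ≤ t
    2+j≤t′ = subst (suc (suc j) ≤_) d+3+j≡t (m≤n+m _ (suc d))

record A₀-at (m N : ℕ) (γ : List ℕ) (q : ℕ) : Set where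
  field
    word    : W m (suc N) γ
    cut     : RCut m N γ q
    bounded : at γ q ≤ suc (at γ N + m)
    γ₁>0    : 0 < at γ 1

record B₀-at (m N : ℕ) (γ : List ℕ) (q : ℕ) : Set where
  field
    word    : W m (suc N) γ
    cut     : R'Cut m N γ q
    bounded : at γ q ≤ suc (at γ N) + m
    climbs  : ∀ i → 2 ≤ i → i ≤ q ∸ 1 → at γ (i ∸ 2) + m < at γ i

A₀⇒A₀-at : ∀ {m N γ} → A₀ m (suc N) γ → Σ ℕ λ q → r m (suc N) γ ≡ suc q × A₀-at m N γ q
A₀⇒A₀-at {N = zero} (_ , _ , s≤s () , _)
A₀⇒A₀-at {m} {suc N} {γ} (word , bounded , _ , γ₁>0) with r-cut m N γ
... | q , r≡1+q , cut = q , r≡1+q , record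
  { word    = word
  ; cut     = cut
  ; bounded = subst (λ R → at γ (R ∸ 1) ≤ suc (at γ (suc N) + m)) r≡1+q bounded
  ; γ₁>0    = γ₁>0
  }

A₀-at⇒A₀ : ∀ {m N γ q} → A₀-at m N γ q → A₀ m (suc N) γ
A₀-at⇒A₀ {m} {N} {γ} a =
  word , subst (λ R → at γ (R ∸ 1) ≤ suc (at γ N + m)) (sym (RCut⇒r≡ cut)) bounded
       , s≤s (≤-trans (RCut.1≤q cut) (RCut.q≤N cut)) , γ₁>0
  where open A₀-at a

B₀⇒B₀-at : ∀ {m N γ} → B₀ m (suc N) γ → Σ ℕ λ q → r' m (suc N) γ ≡ suc q × B₀-at m N γ q
B₀⇒B₀-at {m} {N} {γ} (word , r'>0 , bounded , climbs) with r'-cut m N γ r'>0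
... | q , r'≡1+q , cut = q , r'≡1+q , record
  { word    = word
  ; cut     = cut
  ; bounded = subst (λ R → at γ (R ∸ 1) ≤ suc (at γ N) + m) r'≡1+q bounded
  ; climbs  = λ i 2≤i i≤q∸1 → climbs i 2≤i (subst (λ R → i ≤ R ∸ 2) (sym r'≡1+q) i≤q∸1)
  }

B₀-at⇒B₀ : ∀ {m N γ q} → B₀-at m N γ q → B₀ m (suc N) γ
B₀-at⇒B₀ {m} {N} {γ} {q} b =
  word , subst (0 <_) (sym r'≡1+q) z<s
       , subst (λ R → at γ (R ∸ 1) ≤ suc (at γ N) + m) (sym r'≡1+q) bounded
       , λ i 2≤i i≤r'∸2 → climbs i 2≤i (subst (λ R → i ≤ R ∸ 2) r'≡1+q i≤r'∸2)
  where
  open B₀-at b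
  r'≡1+q : r' m (suc N) γ ≡ suc q
  r'≡1+q = R'Cut⇒r'≡ cut

module F₀-on-A₀ {m N q : ℕ} {γ : List ℕ} (a : A₀-at m N γ q) where

  open A₀-at a
  open RCut cut
  open Positions γ (proj₁ word) q≤N
  open ≤-Reasoning

  private
    instance
      q-nonZero : NonZero q
      q-nonZero = >-nonZero 1≤q

    steps : Steps m N γ
    steps = W⇒Steps γ word

    δ : List ℕ
    δ = f₀-at q γ

    q∸1<q : q ∸ 1 < q
    q∸1<q = ≤-reflexive (suc-pred q)

    γj+m<γq : ∀ j → suc (suc j) ≤ q → at γ j + m < at γ q
    γj+m<γq = overshoot-chain (at γ) m q (λ j → climbs (suc (suc j)) (s≤s (s≤s z≤n)))
                (λ j 2+j≤q → steps (≤-trans 2+j≤q q≤N))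

  γq>0 : 0 < at γ q
  γq>0 with m≤n⇒m<n∨m≡n 1≤q
  ... | inj₁ 1<q  = ≤-<-trans z≤n (γj+m<γq 0 1<q)
  ... | inj₂ refl = γ₁>0

  private
    1+δN≡γq : suc (at δ N) ≡ at γ q
    1+δN≡γq = trans (cong suc f₀-at-last) (suc-pred (at γ q) {{>-nonZero γq>0}})

    δ-steps : Steps m N δ
    δ-steps {k} k<N with <-cmp (suc k) q
    ... | tri< 1+k<q _ _ = begin
      at δ (suc k)  ≡⟨ f₀-at-below 1+k<q ⟩
      at γ (suc k)  ≤⟨ steps k<N ⟩
      at γ k + m    ≡⟨ cong (_+ m) (f₀-at-below (<-trans (n<1+n k) 1+k<q)) ⟨
      at δ k + m    ∎
    ... | tri≈ _ refl _ with m≤n⇒m<n∨m≡n q≤N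
    ...   | inj₁ q<N = begin
      at δ (suc k)        ≡⟨ f₀-at-above ≤-refl q<N ⟩
      at γ (suc (suc k))  ≤⟨ stops q<N ⟩
      at γ k + m          ≡⟨ cong (_+ m) (f₀-at-below (n<1+n k)) ⟨
      at δ k + m          ∎
    ...   | inj₂ refl = begin
      at δ (suc k)        ≡⟨ f₀-at-last ⟩
      at γ (suc k) ∸ 1    ≤⟨ m∸n≤m _ 1 ⟩
      at γ (suc k)        ≤⟨ steps k<N ⟩
      at γ k + m          ≡⟨ cong (_+ m) (f₀-at-below (n<1+n k)) ⟨
      at δ k + m          ∎
    δ-steps {k} k<N | tri> _ _ q<1+k with m≤n⇒m<n∨m≡n k<N
    ... | inj₁ 1+k<N = begin
      at δ (suc k)        ≡⟨ f₀-at-above (<⇒≤ q<1+k) 1+k<N ⟩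
      at γ (suc (suc k))  ≤⟨ steps 1+k<N ⟩
      at γ (suc k) + m    ≡⟨ cong (_+ m) (f₀-at-above (≤-pred q<1+k) k<N) ⟨
      at δ k + m          ∎
    ... | inj₂ refl = begin
      at δ (suc k)        ≡⟨ f₀-at-last ⟩
      at γ q ∸ 1          ≤⟨ ∸-monoˡ-≤ 1 bounded ⟩
      at γ (suc k) + m    ≡⟨ cong (_+ m) (f₀-at-above (≤-pred q<1+k) k<N) ⟨
      at δ k + m          ∎

    δ-below : ∀ j → 2 ≤ j → j ≤ q → at δ (j ∸ 2) + m ≤ at δ N
    δ-below (suc zero) (s≤s ()) _
    δ-below (suc (suc j)) _ 2+j≤q = ≤-pred (begin-strict
      at δ j + m    ≡⟨ cong (_+ m) (f₀-at-below (≤-trans (n≤1+n (suc j)) 2+j≤q)) ⟩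
      at γ j + m    <⟨ γj+m<γq j 2+j≤q ⟩
      at γ q        ≡⟨ 1+δN≡γq ⟨
      suc (at δ N)  ∎)

    δ-cut : R'Cut m N δ q
    δ-cut = record
      { 1≤q     = 1≤q
      ; q≤N     = q≤N
      ; reaches = begin
          suc (at δ N)      ≡⟨ 1+δN≡γq ⟩
          at γ q            ≤⟨ step-into γ steps 1≤q q≤N ⟩
          at γ (q ∸ 1) + m  ≡⟨ cong (_+ m) (f₀-at-below q∸1<q) ⟨
          at δ (q ∸ 1) + m  ∎
      ; below   = δ-below
      }

    δ-bounded : at δ q ≤ suc (at δ N) + m
    δ-bounded with m≤n⇒m<n∨m≡n q≤N
    ... | inj₁ q<N = begin
      at δ q             ≡⟨ f₀-at-above ≤-refl q<N ⟩
      at γ (suc q)       ≤⟨ steps q<N ⟩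
      at γ q + m         ≡⟨ cong (_+ m) 1+δN≡γq ⟨
      suc (at δ N) + m   ∎
    ... | inj₂ refl = ≤-trans (n≤1+n _) (m≤m+n _ m)

    δ-climbs : ∀ i → 2 ≤ i → i ≤ q ∸ 1 → at δ (i ∸ 2) + m < at δ i
    δ-climbs (suc zero) (s≤s ()) _
    δ-climbs (suc (suc i)) 2≤i 2+i≤q∸1 = begin-strict
      at δ i + m             ≡⟨ cong (_+ m) (f₀-at-below (<-trans (m<n+m i z<s) 2+i<q)) ⟩
      at γ i + m             <⟨ climbs (suc (suc i)) 2≤i (<⇒≤ 2+i<q) ⟩
      at γ (suc (suc i))     ≡⟨ f₀-at-below 2+i<q ⟨
      at δ (suc (suc i))     ∎
      where
      2+i<q : suc (suc i) < q
      2+i<q = ≤-<-trans 2+i≤q∸1 q∸1<q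

  f₀-at-B₀-at : B₀-at m N δ q
  f₀-at-B₀-at = record
    { word    = Steps⇒W δ length-f₀-at (trans (f₀-at-below 1≤q) (proj₁ (proj₂ word))) δ-steps
    ; cut     = δ-cut
    ; bounded = δ-bounded
    ; climbs  = δ-climbs
    }

module G₀-on-B₀ {m N q : ℕ} {γ : List ℕ} (b : B₀-at m N γ q) where

  open B₀-at b
  open R'Cut cut
  open Positions γ (proj₁ word) q≤N
  open ≤-Reasoning

  private
    instance
      q-nonZero : NonZero q
      q-nonZero = >-nonZero 1≤q

    steps : Steps m N γ
    steps = W⇒Steps γ word

    ε : List ℕ
    ε = g₀-at N q γ

    q∸1<q : q ∸ 1 < q
    q∸1<q = ≤-reflexive (suc-pred q)

    ε-steps : Steps m N ε
    ε-steps {k} k<N with <-cmp (suc k) q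
    ... | tri< 1+k<q _ _ = begin
      at ε (suc k)  ≡⟨ g₀-at-below 1+k<q ⟩
      at γ (suc k)  ≤⟨ steps k<N ⟩
      at γ k + m    ≡⟨ cong (_+ m) (g₀-at-below (<-trans (n<1+n k) 1+k<q)) ⟨
      at ε k + m    ∎
    ... | tri≈ _ refl _ = begin
      at ε (suc k)  ≡⟨ g₀-at-inserted ⟩
      suc (at γ N)  ≤⟨ reaches ⟩
      at γ k + m    ≡⟨ cong (_+ m) (g₀-at-below (n<1+n k)) ⟨
      at ε k + m    ∎
    ... | tri> _ _ q<1+k with m≤n⇒m<n∨m≡n (≤-pred q<1+k)
    ...   | inj₂ refl = begin
      at ε (suc q)      ≡⟨ g₀-at-above ≤-refl k<N ⟩
      at γ q            ≤⟨ bounded ⟩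
      suc (at γ N) + m  ≡⟨ cong (_+ m) g₀-at-inserted ⟨
      at ε q + m        ∎
    ε-steps {suc k} 1+k<N | tri> _ _ _ | inj₁ q<1+k = begin
      at ε (suc (suc k))  ≡⟨ g₀-at-above (<⇒≤ q<1+k) 1+k<N ⟩
      at γ (suc k)        ≤⟨ steps k<N ⟩
      at γ k + m          ≡⟨ cong (_+ m) (g₀-at-above (≤-pred q<1+k) k<N) ⟨
      at ε (suc k) + m    ∎
      where
      k<N : k < N
      k<N = <-trans (n<1+n k) 1+k<N

    ε-climbs : ∀ j → 2 ≤ j → j ≤ q → at ε (j ∸ 2) + m < at ε j
    ε-climbs (suc zero) (s≤s ()) _
    ε-climbs (suc (suc j)) 2≤j 2+j≤q with m≤n⇒m<n∨m≡n 2+j≤q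
    ... | inj₁ 2+j<q = begin-strict
      at ε j + m          ≡⟨ cong (_+ m) (g₀-at-below (<-trans (m<n+m j z<s) 2+j<q)) ⟩
      at γ j + m          <⟨ climbs (suc (suc j)) 2≤j (<⇒≤pred 2+j<q) ⟩
      at γ (suc (suc j))  ≡⟨ g₀-at-below 2+j<q ⟨
      at ε (suc (suc j))  ∎
    ... | inj₂ refl = begin-strict
      at ε j + m          ≡⟨ cong (_+ m) (g₀-at-below (m<n+m j z<s)) ⟩
      at γ j + m          ≤⟨ below (suc (suc j)) 2≤j ≤-refl ⟩
      at γ N              <⟨ n<1+n _ ⟩
      suc (at γ N)        ≡⟨ g₀-at-inserted ⟨
      at ε (suc (suc j))  ∎

    ε-cut : RCut m N ε q
    ε-cut = record
      { 1≤q    = 1≤q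
      ; q≤N    = q≤N
      ; stops  = λ q<N → begin
          at ε (suc q)      ≡⟨ g₀-at-above ≤-refl q<N ⟩
          at γ q            ≤⟨ step-into γ steps 1≤q q≤N ⟩
          at γ (q ∸ 1) + m  ≡⟨ cong (_+ m) (g₀-at-below q∸1<q) ⟨
          at ε (q ∸ 1) + m  ∎
      ; climbs = ε-climbs
      }

    ε-bounded : at ε q ≤ suc (at ε N + m)
    ε-bounded with m≤n⇒m<n∨m≡n q≤N
    ... | inj₂ refl = ≤-trans (n≤1+n _) (s≤s (m≤m+n _ m))
    ... | inj₁ q<N = begin
      at ε q                  ≡⟨ g₀-at-inserted ⟩
      suc (at γ N)            ≤⟨ s≤s (step-into γ steps 1≤N ≤-refl) ⟩
      suc (at γ (N ∸ 1) + m)  ≡⟨ cong (λ i → suc (i + m)) εN≡γ[N∸1] ⟨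
      suc (at ε N + m)        ∎
      where
      1≤N : 1 ≤ N
      1≤N = ≤-trans 1≤q q≤N
      εN≡γ[N∸1] : at ε N ≡ at γ (N ∸ 1)
      εN≡γ[N∸1] = trans (cong (at ε) (sym (suc-pred N {{>-nonZero 1≤N}})))
                        (g₀-at-above (<⇒≤pred q<N) (≤-reflexive (suc-pred N {{>-nonZero 1≤N}})))

    ε₀≡0 : at ε 0 ≡ 0
    ε₀≡0 = trans (g₀-at-below 1≤q) (proj₁ (proj₂ word))

    ε₁>0 : 0 < at ε 1
    ε₁>0 with m≤n⇒m<n∨m≡n 1≤q
    ... | inj₂ refl = subst (0 <_) (sym g₀-at-inserted) z<s
    ... | inj₁ 2≤q  = +-cancelʳ-< m 0 (at ε 1) (begin-strict
      0 + m       ≡⟨ cong (_+ m) ε₀≡0 ⟨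
      at ε 0 + m  <⟨ ε-climbs 2 ≤-refl 2≤q ⟩
      at ε 2      ≤⟨ ε-steps (≤-trans 2≤q q≤N) ⟩
      at ε 1 + m  ∎)

  g₀-at-A₀-at : A₀-at m N ε q
  g₀-at-A₀-at = record
    { word    = Steps⇒W ε length-g₀-at ε₀≡0 ε-steps
    ; cut     = ε-cut
    ; bounded = ε-bounded
    ; γ₁>0    = ε₁>0
    }

f₀-maps-A₀ : ∀ {m N} γ → A₀ m (suc N) γ →
  B₀ m (suc N) (f₀ m (suc N) γ) × g₀ m (suc N) (f₀ m (suc N) γ) ≡ γ
f₀-maps-A₀ {m} {N} γ a with A₀⇒A₀-at a
... | q , r≡1+q , a′ = subst (B₀ m (suc N)) (sym f₀γ≡) (B₀-at⇒B₀ b) , (begin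
    g₀ m (suc N) (f₀ m (suc N) γ)  ≡⟨ cong (g₀ m (suc N)) f₀γ≡ ⟩
    g₀ m (suc N) (f₀-at q γ)       ≡⟨ g₀≡g₀-at (R'Cut⇒r'≡ (B₀-at.cut b)) ⟩
    g₀-at N q (f₀-at q γ)          ≡⟨ g₀-at∘f₀-at γ (proj₁ word) (RCut.q≤N cut) γq>0 ⟩
    γ                              ∎)
  where
  open ≡-Reasoning
  open A₀-at a′
  f₀γ≡ : f₀ m (suc N) γ ≡ f₀-at q γ
  f₀γ≡ = f₀≡f₀-at {m} {suc N} r≡1+q
  open F₀-on-A₀ a′ using (γq>0)
  b : B₀-at m N (f₀-at q γ) q
  b = F₀-on-A₀.f₀-at-B₀-at a′

g₀-maps-B₀ : ∀ {m N} γ → B₀ m (suc N) γ →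
  A₀ m (suc N) (g₀ m (suc N) γ) × f₀ m (suc N) (g₀ m (suc N) γ) ≡ γ
g₀-maps-B₀ {m} {N} γ b with B₀⇒B₀-at b
... | q , r'≡1+q , b′ = subst (A₀ m (suc N)) (sym g₀γ≡) (A₀-at⇒A₀ a) , (begin
    f₀ m (suc N) (g₀ m (suc N) γ)  ≡⟨ cong (f₀ m (suc N)) g₀γ≡ ⟩
    f₀ m (suc N) (g₀-at N q γ)     ≡⟨ f₀≡f₀-at {m} {suc N} (RCut⇒r≡ (A₀-at.cut a)) ⟩
    f₀-at q (g₀-at N q γ)          ≡⟨ f₀-at∘g₀-at γ (proj₁ word) (R'Cut.q≤N cut) ⟩
    γ                              ∎)
  where
  open ≡-Reasoning
  open B₀-at b′
  g₀γ≡ : g₀ m (suc N) γ ≡ g₀-at N q γ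
  g₀γ≡ = g₀≡g₀-at r'≡1+q
  a : A₀-at m N (g₀-at N q γ) q
  a = G₀-on-B₀.g₀-at-A₀-at b′

lemma3p5 : (m n : ℕ) → 0 < m → 0 < n →
    ((γ : List ℕ) → A₀ m n γ → B₀ m n (f₀ m n γ))
    × ((γ : List ℕ) → B₀ m n γ → A₀ m n (g₀ m n γ))
    × ((γ : List ℕ) → A₀ m n γ → g₀ m n (f₀ m n γ) ≡ γ)
    × ((γ : List ℕ) → B₀ m n γ → f₀ m n (g₀ m n γ) ≡ γ)
lemma3p5 m (suc N) _ _ =
  (λ γ → proj₁ ∘ f₀-maps-A₀ γ) , (λ γ → proj₁ ∘ g₀-maps-B₀ γ) ,
  (λ γ → proj₂ ∘ f₀-maps-A₀ γ) , (λ γ → proj₂ ∘ g₀-maps-B₀ γ)
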